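{- Consider the pawns game and the component notation described in the context. Then: (i) For each integer $m\geq 0$, the component $[m]$ is equivalent to a Nim-heap of some size $\epsilon(m)$; that is, $[m]\cong *\epsilon(m)$. (ii) A move to $[:\!1]$ is loony. For each integer $m>1$, a move to $[:\!m]$ is either loony or equivalent to a move to $[m-1]\cong *\epsilon(m-1)$. The move to $[:\!m]$ is loony if and only if a move to $[:\!(m-1)]$ is not loony and $\epsilon(m-1)=\epsilon(m-2)$. (iii) For any positive integers $m_1,m_2$, a move to $[m_1\!:\!m_2]$ is either loony or equivalent to a move to $[m_1-1]+[m_2-1]\cong *\bigl(\epsilon(m_1-1)\stackrel{*}{+}\epsilon(m_2-1)\bigr)$. The move to $[m_1\!:\!m_2]$ is non-loony if and only if both $m_1$ and $m_2$ satisfy the criterion of (ii) for a move to $[:\!m]$ to be non-loony, i.e. a move to $[:\!m_1]$ and a move to $[:\!m_2]$ are both non-loony. (iv) $\epsilon(0)=0$, $\epsilon(1)=1$, and for $m>1$, $$\epsilon(m)=\operatorname{mex}_{m_1,m_2}\Bigl(\epsilon(m_1-1)\stackrel{*}{+}\epsilon(m_2-1)\Bigr),$$ where the mex runs over the pairs $(m_1,m_2)$ of nonnegative integers with $m_1+m_2=m-1$ such that a move to $[m_1\!:\!m_2]$ is not loony, as determined by (ii) when $m_1m_2=0$ (using $[0\!:\!m]=[m\!:\!0]=[:\!m]$) and by (iii) when $m_1m_2>0$. In this formula, $\epsilon(-1)$ is defined to be $0$.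
   Context: The pawns game. The board has $3$ rows and $n$ files. Initially White pawns occupy some squares of the bottom row, and Black pawns occupy the squares of the top row in exactly the same files. Pawns move as chess pawns (White upward, Black downward): one square straight forward onto an empty square, or a capture of an opposing pawn one square diagonally forward; there is no double step and no en passant. Captures are optional. A player whose pawn reaches the opposite row wins immediately; otherwise the game ends when no move is possible and the player who made the last move wins. Moves allowing the opponent an immediate win are assumed never to be played. A file is initial if it contains its unmoved White pawn in the bottom row and its unmoved Black pawn in the top row. Empty files and files in which no further move can be made split the board into independent components, and a position is the (disjunctive) sum of its components. $[m]$ denotes a component consisting of $m$ consecutive initial files. In play, the following entailing components also arise (a move to an entailing component threatens an immediate win, so the opponent must reply in that component with one of the listed moves): $[:\!m]$ (a pawn just moved to the middle row of a file at the end of a block of $m$ initial files, attacked once and defended once), $[:\!.]$ (a pawn just captured into the middle row and can be captured by an unopposed enemy pawn), $[m\!:\!m']$ (a pawn just moved to the middle row of a file with $m$ initial files on one side and $m'$ on the other, attacked twice and defended twice), $[.\!:\!m]$ (a pawn in the middle row attacked twice and defended once, next to $m$ initial files). Conventions: $[0]=[:\!0]=[0\!:\!0]=0$ (the empty game), $[.\!:\!0]=[:\!.]$, $[m\!:\!0]=[0\!:\!m]=[:\!m]$; mirror images are identified. The available moves (excluding moves conceding an immediate win) are: - From $[m]$, either side may move to $[m_1\!:\!m_2]$ for each $m_1,m_2\geq 0$ with $m_1+m_2=m-1$. - If $m>0$, $[:\!m]$ entails a move to either $[:\!.]+[m-1]$ or $[:\!(m-1)]$. - $[:\!.]$ entails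 a move to $0$. - If $m,m'>0$, $[m\!:\!m']$ entails a move to either $[m-1]+[.\!:\!m']$ or $[m'-1]+[.\!:\!m]$. - If $m>0$, $[.\!:\!m]$ entails a move to $[:\!m]$. A move is loony if, whatever the remaining components of the position are, the opponent has a winning reply. A move to an entailing component is "equivalent to a move to $X$" if, once loony moves are excluded, the forced sequence of entailed replies amounts (for the outcome in every sum with other components) to moving directly to $X$ with the opponent to move. $*k$ denotes a Nim-heap of size $k$; a component is equivalent to $*k$ ($\cong *k$) if, with play restricted to moves that are neither loony nor concede an immediate win, replacing it by $*k$ in any sum does not change the outcome. $\stackrel{*}{+}$ denotes Nim-sum (bitwise XOR) and $\operatorname{mex}$ of a set of nonnegative integers is the least nonnegative integer not in it. -}

module Defs where

open import Data.Nat using (ℕ; zero; suc; _+_; _*_; _<_)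
open import Data.Nat.DivMod using (_/_; _%_)
open import Data.List using (List; []; _∷_; _++_)
open import Data.Maybe using (Maybe; just; nothing)
open import Data.Product using (_×_; _,_; proj₁; proj₂; Σ; ∃)
open import Data.Empty using (⊥)
open import Relation.Nullary using (¬_)
open import Relation.Binary.PropositionalEquality using (_≡_)
open import Function.Bundles using (_⇔_)

-- Nim-sum (bitwise xor) on ℕ.  The fuel (a + b) is always enough, since
-- a number x has at most x binary digits.

xorF : ℕ → ℕ → ℕ → ℕ
xorF zero    a b = 0
xorF (suc f) a b = ((a % 2 + b % 2) % 2) + 2 * xorF f (a / 2) (b / 2)

_⊕_ : ℕ → ℕ → ℕ
a ⊕ b = xorF (a + b) a b

-- Entailing components (all indices are shifted by one so that only
-- genuine components with positive block sizes are representable):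
--   col n    = [:(n+1)]
--   dot      = [:.]
--   two a b  = [(a+1):(b+1)]
--   dcol n   = [.:(n+1)]

data Ent : Set where
  col  : ℕ → Ent
  dot  : Ent
  two  : ℕ → ℕ → Ent
  dcol : ℕ → Ent

-- The result of a move: new initial blocks [m] and possibly one entailing
-- component.
Target : Set
Target = List ℕ × Maybe Ent

-- [:m], with the convention [:0] = 0
colT : ℕ → Target
colT zero    = [] , nothing
colT (suc n) = [] , just (col n)

-- [m1:m2], with [0:0] = 0 and [m:0] = [0:m] = [:m]
pairT : ℕ → ℕ → Target
pairT zero    m       = colT m
pairT (suc a) zero    = colT (suc a)
pairT (suc a) (suc b) = [] , just (two a b)

data EntMove : Ent → Target → Set where
  col-cap : ∀ n → EntMove (col n) (n ∷ [] , just dot)   -- [:(n+1)] → [:.] + [n]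
  col-adv : ∀ n → EntMove (col n) (colT n)               -- [:(n+1)] → [:n]
  dot-cap : EntMove dot ([] , nothing)
  two-l   : ∀ a b → EntMove (two a b) (a ∷ [] , just (dcol b))  -- → [a] + [.:(b+1)]
  two-r   : ∀ a b → EntMove (two a b) (b ∷ [] , just (dcol a))  -- → [b] + [.:(a+1)]
  dcol-mv : ∀ n → EntMove (dcol n) ([] , just (col n))   -- [.:(n+1)] → [:(n+1)]

-- Positions: a sum of initial blocks [m], Nim-heaps *k (to express
-- equivalence with Nim), and at most one entailing component.

record State : Set where
  constructor ⟨_,_,_⟩
  field
    blocks : List ℕ
    heaps  : List ℕ
    ent    : Maybe Ent

infix 4 _⟶_
data _⟶_ : State → State → Set where
  -- move in a block [k+1] to [m1:m2], m1 + m2 = k (only if nothing is entailed)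
  blockMv : ∀ {B H} xs ys k m1 m2 → B ≡ xs ++ suc k ∷ ys → m1 + m2 ≡ k →
            ⟨ B , H , nothing ⟩ ⟶ ⟨ proj₁ (pairT m1 m2) ++ xs ++ ys , H , proj₂ (pairT m1 m2) ⟩
  heapMv  : ∀ {B H} xs ys k j → H ≡ xs ++ suc k ∷ ys → j < suc k →
            ⟨ B , H , nothing ⟩ ⟶ ⟨ B , xs ++ j ∷ ys , nothing ⟩
  -- forced reply in the entailing component
  entMv   : ∀ {B H e} t → EntMove e t →
            ⟨ B , H , just e ⟩ ⟶ ⟨ proj₁ t ++ B , H , proj₂ t ⟩

-- Normal play: the player to move wins / loses.
mutual
  data Win (s : State) : Set where
    win : ∀ {s'} → s ⟶ s' → Lose s' → Win s

  data Lose (s : State) : Set where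
    lose : (∀ {s'} → s ⟶ s' → Win s') → Lose s

-- The position reached by moving to target t, with remaining components
-- R (blocks) and H (heaps); the opponent is to move.
after : Target → List ℕ → List ℕ → State
after t R H = ⟨ proj₁ t ++ R , H , proj₂ t ⟩

Loony : Target → Set
Loony t = ∀ R H → Win (after t R H)

MoveEquiv : Target → List ℕ → Set
MoveEquiv t X = ∀ R H → Win (after t R H) ⇔ Win ⟨ X ++ R , H , nothing ⟩

_≅*_ : List ℕ → ℕ → Set
X ≅* k = ∀ R H E → Win ⟨ X ++ R , H , E ⟩ ⇔ Win ⟨ R , k ∷ H , E ⟩

IsMex : (ℕ → Set) → ℕ → Set
IsMex S v = ¬ S v × (∀ u → u < v → S u)

-- ε(m-1) with the convention ε(-1) = 0
shiftε : (ℕ → ℕ) → ℕ → ℕ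
shiftε ε zero    = 0
shiftε ε (suc n) = ε n

-- the option values of [m] for m = k + 1, as in (iv)
Options : (ℕ → ℕ) → ℕ → ℕ → Set
Options ε k v = Σ ℕ λ m1 → Σ ℕ λ m2 →
  (m1 + m2 ≡ k) × ¬ Loony (pairT m1 m2) × (v ≡ shiftε ε m1 ⊕ shiftε ε m2)

{-# OPTIONS --safe #-}
module Submission where

-- The outcome of every position is given by an explicit labelling.  Let g be
-- the Nim-sum of ε over the initial blocks and of the Nim-heaps.  With nothing
-- entailed the player to move wins iff g ≠ 0 (Bouton); facing [:(n+1)] they win
-- iff the move to it was loony or g ≠ ε(n); facing [(a+1):(b+1)] iff one of
-- [:(a+1)], [:(b+1)] is loony or g ≠ ε(a) ⊕ ε(b).  As ε(m) is the mex of the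
-- values of the non-loony moves from [m], losing labels only lead to winning
-- ones and every winning label has a losing successor; induction on a
-- decreasing measure makes the labelling the outcome.  Loony-ness, the move
-- equivalences and the Nim values of blocks are then read off the labelling.

open import Defs
open import Data.Bool using (Bool; true; false; not; _∧_; _∨_; if_then_else_)
import Data.Bool.Properties as Bool
open import Data.Empty using (⊥; ⊥-elim)
open import Data.List using (List; []; _∷_; _++_; map; foldr; filter; upTo)
open import Data.List.Extrema.Nat using (max; xs≤max)
open import Data.List.Membership.Propositional using (_∈_; _∉_; find)
open import Data.List.Membership.Propositional.Properties
  using (∈-map⁺; ∈-map⁻; ∈-filter⁺; ∈-filter⁻; ∈-upTo⁺; ∈-upTo⁻; ∈-∃++)
open import Data.List.Properties using (map-++; ++-assoc)
import Data.List.Relation.Unary.All as All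
open import Data.List.Relation.Unary.Any using (Any; here; there)
import Data.List.Relation.Unary.Any as Any
import Data.List.Relation.Unary.Any.Properties as Any
open import Data.Maybe using (Maybe; just; nothing)
open import Data.Nat
  using (ℕ; zero; suc; _+_; _∸_; _*_; _<_; _≤_; s≤s; z≤n; _≟_; _≤?_; _≡ᵇ_)
open import Data.List.Membership.DecPropositional _≟_ using (_∈?_)
open import Data.Nat.DivMod
open import Data.Nat.Induction using (<-wellFounded)
open import Data.Nat.ListAction using (sum)
open import Data.Nat.ListAction.Properties using (sum-++)
open import Data.Nat.Properties
open import Data.Nat.Tactic.RingSolver using (solve-∀)
open import Data.Product using (Σ; _×_; _,_; proj₁; proj₂; uncurry)
open import Data.Sum using (_⊎_; inj₁; inj₂)
open import Function using (_∘_; _on_)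
open import Function.Bundles using (_⇔_; mk⇔; Equivalence)
open import Induction.WellFounded using (Acc; acc)
import Relation.Binary.Construct.On as On
open import Relation.Binary.PropositionalEquality
  using (_≡_; _≢_; refl; sym; trans; cong; cong₂; subst; module ≡-Reasoning)
open import Relation.Nullary using (¬_; yes; no; does)
open import Relation.Nullary.Decidable using (dec-true; dec-false)

-- Nim-sum

bit⊕ : ℕ → ℕ → ℕ
bit⊕ a b = (a % 2 + b % 2) % 2

half-sum-< : ∀ a b → 0 < a + b → a / 2 + b / 2 < a + b
half-sum-< (suc a) b _ = +-mono-<-≤ (m/n<m (suc a) 2 (s≤s (s≤s z≤n))) (m/n≤m b 2)
half-sum-< zero (suc b) _ = m/n<m (suc b) 2 (s≤s (s≤s z≤n))

half-sum-≤ : ∀ a b {f} → a + b ≤ suc f → a / 2 + b / 2 ≤ f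
half-sum-≤ zero zero _ = z≤n
half-sum-≤ (suc a) b le = ≤-pred (≤-trans (half-sum-< (suc a) b (s≤s z≤n)) le)
half-sum-≤ zero (suc b) le = ≤-pred (≤-trans (half-sum-< zero (suc b) (s≤s z≤n)) le)

xorF-fuel : ∀ f f' a b → a + b ≤ f → a + b ≤ f' → xorF f a b ≡ xorF f' a b
xorF-fuel zero zero a b _ _ = refl
xorF-fuel zero (suc f') zero zero _ _ = cong (2 *_) (xorF-fuel zero f' 0 0 z≤n z≤n)
xorF-fuel (suc f) zero zero zero _ _ = cong (2 *_) (xorF-fuel f zero 0 0 z≤n z≤n)
xorF-fuel (suc f) (suc f') a b le le' =
  cong (λ z → bit⊕ a b + 2 * z)
       (xorF-fuel f f' (a / 2) (b / 2) (half-sum-≤ a b le) (half-sum-≤ a b le'))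

⊕-unfold : ∀ a b → a ⊕ b ≡ bit⊕ a b + 2 * ((a / 2) ⊕ (b / 2))
⊕-unfold a b = trans (xorF-fuel (a + b) (suc (a + b)) a b ≤-refl (n≤1+n _))
  (cong (λ z → bit⊕ a b + 2 * z)
        (xorF-fuel (a + b) (a / 2 + b / 2) (a / 2) (b / 2) (half-sum-≤ a b (n≤1+n _)) ≤-refl))

private
  bit⊕<2 : ∀ a b → bit⊕ a b < 2
  bit⊕<2 a b = m%n<n (a % 2 + b % 2) 2

  bit+2*q%2 : ∀ r q → r < 2 → (r + 2 * q) % 2 ≡ r
  bit+2*q%2 r q r<2 = begin
    (r + 2 * q) % 2 ≡⟨ cong (λ z → (r + z) % 2) (*-comm 2 q) ⟩
    (r + q * 2) % 2 ≡⟨ [m+kn]%n≡m%n r q 2 ⟩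
    r % 2           ≡⟨ m<n⇒m%n≡m r<2 ⟩
    r               ∎
    where open ≡-Reasoning

  bit+2*q/2 : ∀ r q → r < 2 → (r + 2 * q) / 2 ≡ q
  bit+2*q/2 r q r<2 = begin
    (r + 2 * q) / 2   ≡⟨ cong (λ z → (r + z) / 2) (*-comm 2 q) ⟩
    (r + q * 2) / 2   ≡⟨ +-distrib-/ r (q * 2) no-carry ⟩
    r / 2 + q * 2 / 2 ≡⟨ cong₂ _+_ (m<n⇒m/n≡0 r<2) (m*n/n≡m q 2) ⟩
    q                 ∎
    where
    open ≡-Reasoning
    no-carry : r % 2 + q * 2 % 2 < 2
    no-carry = subst (_< 2) (sym (trans (cong₂ _+_ (m<n⇒m%n≡m r<2) (m*n%n≡0 q 2)) (+-identityʳ r)))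
                     r<2

bits-decomp : ∀ n → n % 2 + 2 * (n / 2) ≡ n
bits-decomp n = sym (trans (m≡m%n+[m/n]*n n 2) (cong (n % 2 +_) (*-comm (n / 2) 2)))

half-≤ : ∀ {x N} → x ≤ suc N → x / 2 ≤ N
half-≤ {x} {N} le = ≤-pred (≤-<-trans (/-monoˡ-≤ 2 le) (m/n<m (suc N) 2 (s≤s (s≤s z≤n))))

⊕-%2 : ∀ a b → (a ⊕ b) % 2 ≡ bit⊕ a b
⊕-%2 a b = trans (cong (_% 2) (⊕-unfold a b))
                     (bit+2*q%2 (bit⊕ a b) ((a / 2) ⊕ (b / 2)) (bit⊕<2 a b))

⊕-/2 : ∀ a b → (a ⊕ b) / 2 ≡ (a / 2) ⊕ (b / 2)
⊕-/2 a b = trans (cong (_/ 2) (⊕-unfold a b))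
                   (bit+2*q/2 (bit⊕ a b) ((a / 2) ⊕ (b / 2)) (bit⊕<2 a b))

⊕-identityʳ : ∀ x → x ⊕ 0 ≡ x
⊕-identityʳ x = go x x ≤-refl
  where
  open ≡-Reasoning
  go : ∀ N x → x ≤ N → x ⊕ 0 ≡ x
  go zero .zero z≤n = refl
  go (suc N) x le = begin
    x ⊕ 0
      ≡⟨ ⊕-unfold x 0 ⟩
    (x % 2 + 0) % 2 + 2 * ((x / 2) ⊕ 0)
      ≡⟨ cong₂ (λ u v → u % 2 + 2 * v) (+-identityʳ (x % 2)) (go N (x / 2) (half-≤ le)) ⟩
    x % 2 % 2 + 2 * (x / 2)
      ≡⟨ cong (_+ 2 * (x / 2)) (m%n%n≡m%n x 2) ⟩
    x % 2 + 2 * (x / 2)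
      ≡⟨ bits-decomp x ⟩
    x
      ∎

⊕-comm : ∀ x y → x ⊕ y ≡ y ⊕ x
⊕-comm x y = go (x + y) x y (m≤m+n x y) (m≤n+m y x)
  where
  open ≡-Reasoning
  go : ∀ N x y → x ≤ N → y ≤ N → x ⊕ y ≡ y ⊕ x
  go zero .zero .zero z≤n z≤n = refl
  go (suc N) x y x≤ y≤ = begin
    x ⊕ y
      ≡⟨ ⊕-unfold x y ⟩
    (x % 2 + y % 2) % 2 + 2 * ((x / 2) ⊕ (y / 2))
      ≡⟨ cong₂ (λ u v → u % 2 + 2 * v) (+-comm (x % 2) (y % 2))
               (go N (x / 2) (y / 2) (half-≤ x≤) (half-≤ y≤)) ⟩
    (y % 2 + x % 2) % 2 + 2 * ((y / 2) ⊕ (x / 2))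
      ≡⟨ ⊕-unfold y x ⟨
    y ⊕ x
      ∎

⊕-identityˡ : ∀ x → 0 ⊕ x ≡ x
⊕-identityˡ x = trans (⊕-comm 0 x) (⊕-identityʳ x)

x⊕x≡0 : ∀ x → x ⊕ x ≡ 0
x⊕x≡0 x = go x x ≤-refl
  where
  open ≡-Reasoning
  r+r%2≡0 : ∀ r → (r + r) % 2 ≡ 0
  r+r%2≡0 r = trans (cong (λ z → (r + z) % 2) (sym (+-identityʳ r)))
                    (trans (cong (_% 2) (*-comm 2 r)) (m*n%n≡0 r 2))
  go : ∀ N x → x ≤ N → x ⊕ x ≡ 0
  go zero .zero z≤n = refl
  go (suc N) x le = begin
    x ⊕ x
      ≡⟨ ⊕-unfold x x ⟩
    (x % 2 + x % 2) % 2 + 2 * ((x / 2) ⊕ (x / 2))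
      ≡⟨ cong₂ (λ u v → u + 2 * v) (r+r%2≡0 (x % 2)) (go N (x / 2) (half-≤ le)) ⟩
    0
      ∎

⊕-assoc : ∀ a b c → (a ⊕ b) ⊕ c ≡ a ⊕ (b ⊕ c)
⊕-assoc a b c = go (a + b + c) a b c (≤-trans (m≤m+n a b) (m≤m+n (a + b) c))
                   (≤-trans (m≤n+m b a) (m≤m+n (a + b) c)) (m≤n+m c (a + b))
  where
  open ≡-Reasoning
  bit-assoc : ∀ p q r → ((p + q) % 2 + r) % 2 ≡ (p + (q + r) % 2) % 2
  bit-assoc p q r = begin
    ((p + q) % 2 + r) % 2 ≡⟨ %-distribˡ-+ ((p + q) % 2) r 2 ⟩
    ((p + q) % 2 % 2 + r % 2) % 2 ≡⟨ cong (λ u → (u + r % 2) % 2) (m%n%n≡m%n (p + q) 2) ⟩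
    ((p + q) % 2 + r % 2) % 2 ≡⟨ %-distribˡ-+ (p + q) r 2 ⟨
    (p + q + r) % 2 ≡⟨ cong (_% 2) (+-assoc p q r) ⟩
    (p + (q + r)) % 2 ≡⟨ %-distribˡ-+ p (q + r) 2 ⟩
    (p % 2 + (q + r) % 2) % 2 ≡⟨ cong (λ u → (p % 2 + u) % 2) (m%n%n≡m%n (q + r) 2) ⟨
    (p % 2 + (q + r) % 2 % 2) % 2 ≡⟨ %-distribˡ-+ p ((q + r) % 2) 2 ⟨
    (p + (q + r) % 2) % 2 ∎
  go : ∀ N a b c → a ≤ N → b ≤ N → c ≤ N → (a ⊕ b) ⊕ c ≡ a ⊕ (b ⊕ c)
  go zero .zero .zero .zero z≤n z≤n z≤n = refl
  go (suc N) a b c a≤ b≤ c≤ = begin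
    (a ⊕ b) ⊕ c
      ≡⟨ ⊕-unfold (a ⊕ b) c ⟩
    ((a ⊕ b) % 2 + c % 2) % 2 + 2 * (((a ⊕ b) / 2) ⊕ (c / 2))
      ≡⟨ cong₂ (λ u v → (u + c % 2) % 2 + 2 * (v ⊕ (c / 2))) (⊕-%2 a b) (⊕-/2 a b) ⟩
    (bit⊕ a b + c % 2) % 2 + 2 * (((a / 2) ⊕ (b / 2)) ⊕ (c / 2))
      ≡⟨ cong₂ (λ u v → u + 2 * v) (bit-assoc (a % 2) (b % 2) (c % 2))
               (go N (a / 2) (b / 2) (c / 2) (half-≤ a≤) (half-≤ b≤) (half-≤ c≤)) ⟩
    (a % 2 + bit⊕ b c) % 2 + 2 * ((a / 2) ⊕ ((b / 2) ⊕ (c / 2)))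
      ≡⟨ cong₂ (λ u v → (a % 2 + u) % 2 + 2 * ((a / 2) ⊕ v)) (⊕-%2 b c) (⊕-/2 b c) ⟨
    (a % 2 + (b ⊕ c) % 2) % 2 + 2 * ((a / 2) ⊕ ((b ⊕ c) / 2))
      ≡⟨ ⊕-unfold a (b ⊕ c) ⟨
    a ⊕ (b ⊕ c)
      ∎

x⊕[x⊕y]≡y : ∀ x y → x ⊕ (x ⊕ y) ≡ y
x⊕[x⊕y]≡y x y = trans (sym (⊕-assoc x x y)) (trans (cong (_⊕ y) (x⊕x≡0 x)) (⊕-identityˡ y))

⊕-cancelˡ : ∀ x {y z} → x ⊕ y ≡ x ⊕ z → y ≡ z
⊕-cancelˡ x {y} {z} eq = trans (sym (x⊕[x⊕y]≡y x y)) (trans (cong (x ⊕_) eq) (x⊕[x⊕y]≡y x z))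

x⊕y≡0⇒x≡y : ∀ x y → x ⊕ y ≡ 0 → x ≡ y
x⊕y≡0⇒x≡y x y eq = sym (⊕-cancelˡ x (trans eq (sym (x⊕x≡0 x))))

⊕-swapˡ : ∀ x y z → x ⊕ (y ⊕ z) ≡ y ⊕ (x ⊕ z)
⊕-swapˡ x y z = trans (sym (⊕-assoc x y z)) (trans (cong (_⊕ z) (⊕-comm x y)) (⊕-assoc y x z))

⨁ : List ℕ → ℕ
⨁ = foldr _⊕_ 0

⨁-middle : ∀ xs c ys → ⨁ (xs ++ c ∷ ys) ≡ c ⊕ ⨁ (xs ++ ys)
⨁-middle [] c ys = refl
⨁-middle (x ∷ xs) c ys = trans (cong (x ⊕_) (⨁-middle xs c ys)) (⊕-swapˡ x c _)

⨁-/2 : ∀ l → ⨁ (map (_/ 2) l) ≡ ⨁ l / 2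
⨁-/2 [] = refl
⨁-/2 (c ∷ l) = trans (cong ((c / 2) ⊕_) (⨁-/2 l)) (sym (⊕-/2 c (⨁ l)))

private
  %2≡0⊎%2≡1 : ∀ n → n % 2 ≡ 0 ⊎ n % 2 ≡ 1
  %2≡0⊎%2≡1 n with n % 2 | m%n<n n 2
  ... | 0 | _ = inj₁ refl
  ... | 1 | _ = inj₂ refl
  ... | suc (suc _) | s≤s (s≤s ())

  odd-member : ∀ l → ⨁ l % 2 ≡ 1 → Any (λ c → c % 2 ≡ 1) l
  odd-member (c ∷ l) odd with %2≡0⊎%2≡1 c
  ... | inj₂ c-odd = here c-odd
  ... | inj₁ c-even = there (odd-member l (begin
     ⨁ l % 2                  ≡⟨ m%n%n≡m%n (⨁ l) 2 ⟨
     (0 + ⨁ l % 2) % 2        ≡⟨ cong (λ u → (u + ⨁ l % 2) % 2) c-even ⟨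
     (c % 2 + ⨁ l % 2) % 2    ≡⟨ ⊕-%2 c (⨁ l) ⟨
     (c ⊕ ⨁ l) % 2            ≡⟨ odd ⟩
     1                        ∎))
    where open ≡-Reasoning

  odd⇒x⊕1<x : ∀ c → c % 2 ≡ 1 → c ⊕ 1 < c
  odd⇒x⊕1<x c odd = subst (c ⊕ 1 <_) (trans (cong (_+ 2 * (c / 2)) (sym odd)) (bits-decomp c))
    (≤-reflexive (cong suc (trans (⊕-unfold c 1)
                                  (cong₂ (λ u v → (u + 1) % 2 + 2 * v) odd (⊕-identityʳ (c / 2))))))

  n/2≡0⇒n≡1 : ∀ n → n / 2 ≡ 0 → n ≢ 0 → n ≡ 1
  n/2≡0⇒n≡1 zero _ nz = ⊥-elim (nz refl)
  n/2≡0⇒n≡1 (suc zero) _ _ = refl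
  n/2≡0⇒n≡1 (suc (suc n)) half≡0 _ with m/n≡0⇒m<n {suc (suc n)} {2} half≡0
  ... | s≤s (s≤s ())

  ⊕-<-from-/2 : ∀ c g → (c / 2) ⊕ (g / 2) < c / 2 → c ⊕ g < c
  ⊕-<-from-/2 c g lt = begin-strict
    c ⊕ g                                      ≡⟨ ⊕-unfold c g ⟩
    bit⊕ c g + 2 * ((c / 2) ⊕ (g / 2))         ≤⟨ +-monoˡ-≤ _ (≤-pred (bit⊕<2 c g)) ⟩
    1 + 2 * ((c / 2) ⊕ (g / 2))                <⟨ n<1+n _ ⟩
    2 + 2 * ((c / 2) ⊕ (g / 2))                ≡⟨ *-suc 2 _ ⟨
    2 * suc ((c / 2) ⊕ (g / 2))                ≤⟨ *-monoʳ-≤ 2 lt ⟩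
    2 * (c / 2)                                ≤⟨ m≤n+m _ (c % 2) ⟩
    c % 2 + 2 * (c / 2)                        ≡⟨ bits-decomp c ⟩
    c                                          ∎
    where open ≤-Reasoning

-- Bouton's lemma, by induction on halving: once ⨁ l = 1, lower an odd heap by one.
⨁-reducible : ∀ l → ⨁ l ≢ 0 → Any (λ c → c ⊕ ⨁ l < c) l
⨁-reducible l nz = go (⨁ l) l ≤-refl nz
  where
  go : ∀ N l → ⨁ l ≤ N → ⨁ l ≢ 0 → Any (λ c → c ⊕ ⨁ l < c) l
  go zero l le nz = ⊥-elim (nz (n≤0⇒n≡0 le))
  go (suc N) l le nz with ⨁ l / 2 ≟ 0
  ... | no half≢0 =
    Any.map (λ {c} → ⊕-<-from-/2 c (⨁ l) ∘ subst (λ g → (c / 2) ⊕ g < c / 2) (⨁-/2 l))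
            (Any.map⁻ (go N (map (_/ 2) l) (subst (_≤ N) (sym (⨁-/2 l)) (half-≤ le))
                                             (half≢0 ∘ trans (sym (⨁-/2 l)))))
  ... | yes half≡0 = Any.map (λ {c} odd → subst (λ g → c ⊕ g < c) (sym ⨁l≡1) (odd⇒x⊕1<x c odd))
                             (odd-member l (cong (_% 2) ⨁l≡1))
    where
    ⨁l≡1 : ⨁ l ≡ 1
    ⨁l≡1 = n/2≡0⇒n≡1 (⨁ l) half≡0 nz

-- The sequence ε

mexFrom : List ℕ → ℕ → ℕ → ℕ
mexFrom l zero u = u
mexFrom l (suc n) u with u ∈? l
... | yes _ = mexFrom l n (suc u)
... | no  _ = u

mex : List ℕ → ℕ
mex l = mexFrom l (suc (max 0 l)) 0

mex-isMex : ∀ l → IsMex (_∈ l) (mex l)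
mex-isMex l = go (suc (max 0 l)) 0 (λ _ ()) (+-identityʳ _)
  where
  ∉-above-max : ∀ {u} → max 0 l < u → u ∉ l
  ∉-above-max max<u u∈l = <⇒≱ max<u (All.lookup (xs≤max 0 l) u∈l)
  go : ∀ n u → (∀ v → v < u → v ∈ l) → n + u ≡ suc (max 0 l) → IsMex (_∈ l) (mexFrom l n u)
  go zero u below refl = ∉-above-max ≤-refl , below
  go (suc n) u below eq with u ∈? l
  ... | no u∉l = u∉l , below
  ... | yes u∈l = go n (suc u) below′ (trans (+-suc n u) eq)
    where
    below′ : ∀ v → v < suc u → v ∈ l
    below′ v v<1+u with m≤n⇒m<n∨m≡n (≤-pred v<1+u)
    ... | inj₁ v<u = below v v<u
    ... | inj₂ refl = u∈l

-- colLoonyᵇ f n decides whether a move to [:(n+1)] is loony, when f is ε.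
colLoonyᵇ : (ℕ → ℕ) → ℕ → Bool
colLoonyᵇ f zero    = true
colLoonyᵇ f (suc n) = not (colLoonyᵇ f n) ∧ (f (suc n) ≡ᵇ f n)

pairLoonyᵇ : (ℕ → ℕ) → ℕ → ℕ → Bool
pairLoonyᵇ f zero    zero    = false
pairLoonyᵇ f zero    (suc b) = colLoonyᵇ f b
pairLoonyᵇ f (suc a) zero    = colLoonyᵇ f a
pairLoonyᵇ f (suc a) (suc b) = colLoonyᵇ f a ∨ colLoonyᵇ f b

optionValue : (ℕ → ℕ) → ℕ → ℕ → ℕ
optionValue f m1 m2 = shiftε f m1 ⊕ shiftε f m2

IsOption : (ℕ → ℕ) → ℕ → ℕ → Set
IsOption f k v = Σ ℕ λ m1 → Σ ℕ λ m2 →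
  (m1 + m2 ≡ k) × (pairLoonyᵇ f m1 m2 ≡ false) × (v ≡ optionValue f m1 m2)

splits : ℕ → List (ℕ × ℕ)
splits k = map (λ i → i , k ∸ i) (upTo (suc k))

∈-splits⁺ : ∀ {m1 m2 k} → m1 + m2 ≡ k → (m1 , m2) ∈ splits k
∈-splits⁺ {m1} {m2} refl = subst (λ z → (m1 , z) ∈ splits (m1 + m2)) (m+n∸m≡n m1 m2)
  (∈-map⁺ (λ i → i , (m1 + m2) ∸ i) (∈-upTo⁺ (s≤s (m≤m+n m1 m2))))

∈-splits⁻ : ∀ {m1 m2 k} → (m1 , m2) ∈ splits k → m1 + m2 ≡ k
∈-splits⁻ p with ∈-map⁻ (λ i → i , _ ∸ i) p
... | i , i∈ , refl = m+[n∸m]≡n (≤-pred (∈-upTo⁻ i∈))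

optionList : (ℕ → ℕ) → ℕ → List ℕ
optionList f k = map (uncurry (optionValue f))
                     (filter (λ p → uncurry (pairLoonyᵇ f) p Bool.≟ false) (splits k))

∈-optionList⁺ : ∀ {f k v} → IsOption f k v → v ∈ optionList f k
∈-optionList⁺ {f} (m1 , m2 , refl , nl , refl) =
  ∈-map⁺ (uncurry (optionValue f))
         (∈-filter⁺ (λ p → uncurry (pairLoonyᵇ f) p Bool.≟ false) (∈-splits⁺ {m1} {m2} refl) nl)

∈-optionList⁻ : ∀ {f k v} → v ∈ optionList f k → IsOption f k v
∈-optionList⁻ {f} v∈ with ∈-map⁻ (uncurry (optionValue f)) v∈
... | (m1 , m2) , p∈ , refl with ∈-filter⁻ (λ p → uncurry (pairLoonyᵇ f) p Bool.≟ false) p∈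
... | p∈splits , nl = m1 , m2 , ∈-splits⁻ p∈splits , nl , refl

Agree : (ℕ → ℕ) → (ℕ → ℕ) → ℕ → Set
Agree f g k = ∀ i → i ≤ k → f i ≡ g i

Agree-sym : ∀ {f g k} → Agree f g k → Agree g f k
Agree-sym ag i le = sym (ag i le)

Agree-mono : ∀ {f g k n} → n ≤ k → Agree f g k → Agree f g n
Agree-mono n≤k ag i i≤n = ag i (≤-trans i≤n n≤k)

colLoonyᵇ-cong : ∀ {f g} n → Agree f g n → colLoonyᵇ f n ≡ colLoonyᵇ g n
colLoonyᵇ-cong zero    ag = refl
colLoonyᵇ-cong (suc n) ag =
  cong₂ (λ l e → not l ∧ e) (colLoonyᵇ-cong n (Agree-mono (n≤1+n n) ag))
                            (cong₂ _≡ᵇ_ (ag (suc n) ≤-refl) (ag n (n≤1+n n)))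

pairLoonyᵇ-cong : ∀ {f g} m1 m2 → Agree f g (m1 + m2) → pairLoonyᵇ f m1 m2 ≡ pairLoonyᵇ g m1 m2
pairLoonyᵇ-cong zero    zero    ag = refl
pairLoonyᵇ-cong zero    (suc b) ag = colLoonyᵇ-cong b (Agree-mono (n≤1+n b) ag)
pairLoonyᵇ-cong (suc a) zero    ag = colLoonyᵇ-cong a (Agree-mono (≤-trans (n≤1+n a) (m≤m+n _ 0)) ag)
pairLoonyᵇ-cong (suc a) (suc b) ag =
  cong₂ _∨_ (colLoonyᵇ-cong a (Agree-mono (≤-trans (n≤1+n a) (m≤m+n _ _)) ag))
            (colLoonyᵇ-cong b (Agree-mono (≤-trans (n≤1+n b) (m≤n+m _ (suc a))) ag))

shiftε-cong : ∀ {f g k} m → m ≤ k → Agree f g k → shiftε f m ≡ shiftε g m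
shiftε-cong zero    _   ag = refl
shiftε-cong (suc m) m<k ag = ag m (≤-trans (n≤1+n m) m<k)

optionValue-cong : ∀ {f g} m1 m2 → Agree f g (m1 + m2) → optionValue f m1 m2 ≡ optionValue g m1 m2
optionValue-cong m1 m2 ag =
  cong₂ _⊕_ (shiftε-cong m1 (m≤m+n m1 m2) ag) (shiftε-cong m2 (m≤n+m m2 m1) ag)

IsOption-cong : ∀ {f g k v} → Agree f g k → IsOption f k v → IsOption g k v
IsOption-cong ag (m1 , m2 , refl , nl , refl) =
  m1 , m2 , refl , trans (sym (pairLoonyᵇ-cong m1 m2 ag)) nl , optionValue-cong m1 m2 ag

-- A course-of-values table: row k + 1 extends row k by the mex computed from it.
εUpTo : ℕ → ℕ → ℕ
εUpTo zero    _ = 0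
εUpTo (suc k) i = if does (i ≤? k) then εUpTo k i else mex (optionList (εUpTo k) k)

ε : ℕ → ℕ
ε n = εUpTo n n

εUpTo-agree : ∀ k → Agree (εUpTo k) ε k
εUpTo-agree zero .zero z≤n = refl
εUpTo-agree (suc k) i i≤1+k with m≤n⇒m<n∨m≡n i≤1+k
... | inj₁ i<1+k rewrite dec-true (i ≤? k) (≤-pred i<1+k) = εUpTo-agree k i (≤-pred i<1+k)
... | inj₂ refl = refl

ε-suc : ∀ k → ε (suc k) ≡ mex (optionList (εUpTo k) k)
ε-suc k rewrite dec-false (suc k ≤? k) 1+n≰n = refl

ε-suc-isMex : ∀ k → IsMex (IsOption ε k) (ε (suc k))
ε-suc-isMex k rewrite ε-suc k with mex-isMex (optionList (εUpTo k) k)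
... | mex∉ , below-mex =
  (λ opt → mex∉ (∈-optionList⁺ (IsOption-cong (Agree-sym (εUpTo-agree k)) opt))) ,
  (λ u u<mex → IsOption-cong (εUpTo-agree k) (∈-optionList⁻ (below-mex u u<mex)))

-- Termination

μEnt : Maybe Ent → ℕ
μEnt nothing           = 0
μEnt (just dot)        = 1
μEnt (just (col n))    = 2 + 2 * n
μEnt (just (dcol n))   = 3 + 2 * n
μEnt (just (two a b))  = 4 + (2 * a + 2 * b)

μTarget : Target → ℕ
μTarget (X , e) = μEnt e + 2 * sum X

μ : State → ℕ
μ ⟨ B , H , e ⟩ = μEnt e + (2 * sum B + sum H)

private
  <-from-gap : ∀ d {x y} → suc (d + x) ≡ y → x < y
  <-from-gap d {x} refl = s≤s (m≤n+m x d)

  sum-middle : ∀ xs c ys → sum (xs ++ c ∷ ys) ≡ c + sum (xs ++ ys)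
  sum-middle []       c ys = refl
  sum-middle (x ∷ xs) c ys = trans (cong (x +_) (sum-middle xs c ys)) (+-swap x c _)
    where
    +-swap : ∀ x c r → x + (c + r) ≡ c + (x + r)
    +-swap = solve-∀

μ-prepend : ∀ X B H e → μ ⟨ X ++ B , H , e ⟩ ≡ μTarget (X , e) + μ ⟨ B , H , nothing ⟩
μ-prepend X B H e rewrite sum-++ X B = rearrange (μEnt e) (sum X) (sum B) (sum H)
  where
  rearrange : ∀ m x b h → m + (2 * (x + b) + h) ≡ m + 2 * x + (0 + (2 * b + h))
  rearrange = solve-∀

μ-middle : ∀ xs c ys H →
           μ ⟨ xs ++ c ∷ ys , H , nothing ⟩ ≡ 2 * c + μ ⟨ xs ++ ys , H , nothing ⟩
μ-middle xs c ys H rewrite sum-middle xs c ys = rearrange c (sum (xs ++ ys)) (sum H)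
  where
  rearrange : ∀ c r h → 2 * (c + r) + h ≡ 2 * c + (2 * r + h)
  rearrange = solve-∀

μTarget-pairT : ∀ m1 m2 → μTarget (pairT m1 m2) < 2 * suc (m1 + m2)
μTarget-pairT zero    zero    = s≤s z≤n
μTarget-pairT zero    (suc b) = <-from-gap 1 (gap b)
  where
  gap : ∀ b → suc (1 + (2 + 2 * b + 2 * 0)) ≡ 2 * suc (suc b)
  gap = solve-∀
μTarget-pairT (suc a) zero    = <-from-gap 1 (gap a)
  where
  gap : ∀ a → suc (1 + (2 + 2 * a + 2 * 0)) ≡ 2 * suc (suc a + 0)
  gap = solve-∀
μTarget-pairT (suc a) (suc b) = <-from-gap 1 (gap a b)
  where
  gap : ∀ a b → suc (1 + (4 + (2 * a + 2 * b) + 2 * 0)) ≡ 2 * suc (suc a + suc b)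
  gap = solve-∀

μTarget-entMove : ∀ {e t} → EntMove e t → μTarget t < μEnt (just e)
μTarget-entMove (col-cap n)       = <-from-gap 0 (gap n)
  where
  gap : ∀ n → suc (0 + (1 + 2 * (n + 0))) ≡ 2 + 2 * n
  gap = solve-∀
μTarget-entMove (col-adv zero)    = s≤s z≤n
μTarget-entMove (col-adv (suc n)) = <-from-gap 1 (gap n)
  where
  gap : ∀ n → suc (1 + (2 + 2 * n + 2 * 0)) ≡ 2 + 2 * suc n
  gap = solve-∀
μTarget-entMove dot-cap           = s≤s z≤n
μTarget-entMove (two-l a b)       = <-from-gap 0 (gap a b)
  where
  gap : ∀ a b → suc (0 + (3 + 2 * b + 2 * (a + 0))) ≡ 4 + (2 * a + 2 * b)
  gap = solve-∀
μTarget-entMove (two-r a b)       = <-from-gap 0 (gap a b)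
  where
  gap : ∀ a b → suc (0 + (3 + 2 * a + 2 * (b + 0))) ≡ 4 + (2 * a + 2 * b)
  gap = solve-∀
μTarget-entMove (dcol-mv n)       = <-from-gap 0 (gap n)
  where
  gap : ∀ n → suc (0 + (2 + 2 * n + 2 * 0)) ≡ 3 + 2 * n
  gap = solve-∀

μ-decreasing : ∀ {s s'} → s ⟶ s' → μ s' < μ s
μ-decreasing (blockMv {B} {H} xs ys k m1 m2 refl refl) = begin-strict
  μ (after (pairT m1 m2) (xs ++ ys) H)
    ≡⟨ μ-prepend (proj₁ (pairT m1 m2)) (xs ++ ys) H (proj₂ (pairT m1 m2)) ⟩
  μTarget (pairT m1 m2) + μ ⟨ xs ++ ys , H , nothing ⟩
    <⟨ +-monoˡ-< _ (μTarget-pairT m1 m2) ⟩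
  2 * suc k + μ ⟨ xs ++ ys , H , nothing ⟩
    ≡⟨ μ-middle xs (suc k) ys H ⟨
  μ ⟨ xs ++ suc k ∷ ys , H , nothing ⟩
    ∎
  where open ≤-Reasoning
μ-decreasing (heapMv {B} {H} xs ys k j refl j<1+k) = +-monoʳ-< (2 * sum B) (begin-strict
  sum (xs ++ j ∷ ys)       ≡⟨ sum-middle xs j ys ⟩
  j + sum (xs ++ ys)       <⟨ +-monoˡ-< _ j<1+k ⟩
  suc k + sum (xs ++ ys)   ≡⟨ sum-middle xs (suc k) ys ⟨
  sum (xs ++ suc k ∷ ys)   ∎)
  where open ≤-Reasoning
μ-decreasing (entMv {B} {H} {e} t mv) = begin-strict
  μ ⟨ proj₁ t ++ B , H , proj₂ t ⟩      ≡⟨ μ-prepend (proj₁ t) B H (proj₂ t) ⟩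
  μTarget t + μ ⟨ B , H , nothing ⟩     <⟨ +-monoˡ-< _ (μTarget-entMove mv) ⟩
  μ ⟨ B , H , just e ⟩                  ∎
  where open ≤-Reasoning

-- Outcomes

Win-Lose-exclusive : ∀ {s} → Win s → Lose s → ⊥
Win-Lose-exclusive (win mv (lose replies)) (lose moves) with moves mv
... | win mv′ lost = Win-Lose-exclusive (replies mv′) lost

module Outcome
  (wins : State → Bool)
  (losing-closed : ∀ {s s'} → wins s ≡ false → s ⟶ s' → wins s' ≡ true)
  (winning-move : ∀ s → wins s ≡ true → Σ State λ s' → (s ⟶ s') × (wins s' ≡ false))
  where

  private
    decide : ∀ s → Acc (_<_ on μ) s → (wins s ≡ true → Win s) × (wins s ≡ false → Lose s)
    decide s (acc rec) =
      (λ w → let (s' , mv , l) = winning-move s w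
             in win mv (proj₂ (decide s' (rec (μ-decreasing mv))) l)) ,
      (λ l → lose (λ mv → proj₁ (decide _ (rec (μ-decreasing mv))) (losing-closed l mv)))

    decide′ : ∀ s → (wins s ≡ true → Win s) × (wins s ≡ false → Lose s)
    decide′ s = decide s (On.wellFounded μ <-wellFounded s)

  Win⇔wins : ∀ s → Win s ⇔ wins s ≡ true
  Win⇔wins s = mk⇔ to (proj₁ (decide′ s))
    where
    to : Win s → wins s ≡ true
    to w with wins s in eq
    ... | true  = refl
    ... | false = ⊥-elim (Win-Lose-exclusive w (proj₂ (decide′ s) eq))

private
  ≡⇒≡ᵇ-true : ∀ {m n} → m ≡ n → (m ≡ᵇ n) ≡ true
  ≡⇒≡ᵇ-true {m} {n} eq = Equivalence.to Bool.T-≡ (≡⇒≡ᵇ m n eq)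

  ≡ᵇ-true⇒≡ : ∀ {m n} → (m ≡ᵇ n) ≡ true → m ≡ n
  ≡ᵇ-true⇒≡ {m} {n} eq = ≡ᵇ⇒≡ m n (Equivalence.from Bool.T-≡ eq)

  not-≡ᵇ-true : ∀ {m n} → m ≢ n → not (m ≡ᵇ n) ≡ true
  not-≡ᵇ-true {m} {n} m≢n with m ≡ᵇ n in eq
  ... | true  = ⊥-elim (m≢n (≡ᵇ-true⇒≡ eq))
  ... | false = refl

  not-≡ᵇ-true⁻ : ∀ {m n} → not (m ≡ᵇ n) ≡ true → m ≢ n
  not-≡ᵇ-true⁻ w m≡n rewrite ≡⇒≡ᵇ-true m≡n with w
  ... | ()

  not-≡ᵇ-false⁻ : ∀ {m n} → not (m ≡ᵇ n) ≡ false → m ≡ n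
  not-≡ᵇ-false⁻ l = ≡ᵇ-true⇒≡ (Bool.not-injective l)

  ∨-not-≡ᵇ-true : ∀ b {m n} → (b ≡ false → m ≢ n) → b ∨ not (m ≡ᵇ n) ≡ true
  ∨-not-≡ᵇ-true true  _  = refl
  ∨-not-≡ᵇ-true false ne = not-≡ᵇ-true (ne refl)

  ∨-not-≡ᵇ-true⁻ : ∀ b {m n} → b ∨ not (m ≡ᵇ n) ≡ true → m ≡ n → b ≡ true
  ∨-not-≡ᵇ-true⁻ true  _ _ = refl
  ∨-not-≡ᵇ-true⁻ false w m≡n = ⊥-elim (not-≡ᵇ-true⁻ w m≡n)

  ∨-not-≡ᵇ-false : ∀ {b m n} → b ≡ false → m ≡ n → b ∨ not (m ≡ᵇ n) ≡ false
  ∨-not-≡ᵇ-false refl m≡n = cong not (≡⇒≡ᵇ-true m≡n)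

  ∨-not-≡ᵇ-false⁻ : ∀ b {m n} → b ∨ not (m ≡ᵇ n) ≡ false → b ≡ false × m ≡ n
  ∨-not-≡ᵇ-false⁻ false l = refl , not-≡ᵇ-false⁻ l

  ∨-≡-false⇔ : ∀ {x y} → x ∨ y ≡ false ⇔ (x ≡ false × y ≡ false)
  ∨-≡-false⇔ {x} {y} = mk⇔ (λ l → Bool.∨-conicalˡ x y l , Bool.∨-conicalʳ x y l)
                            (λ { (refl , refl) → refl })

  not-∧-≡ᵇ-true⇔ : ∀ {x m n} → not x ∧ (m ≡ᵇ n) ≡ true ⇔ (x ≡ false × m ≡ n)
  not-∧-≡ᵇ-true⇔ {x} = mk⇔ (to x) (λ { (refl , m≡n) → ≡⇒≡ᵇ-true m≡n })
    where
    to : ∀ x {m n} → not x ∧ (m ≡ᵇ n) ≡ true → x ≡ false × m ≡ n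
    to false t = refl , ≡ᵇ-true⇒≡ t

colLoony : ℕ → Bool
colLoony = colLoonyᵇ ε

pairLoony : ℕ → ℕ → Bool
pairLoony = pairLoonyᵇ ε

colLoony-suc⇔ : ∀ n → colLoony (suc n) ≡ true ⇔ (colLoony n ≡ false × ε (suc n) ≡ ε n)
colLoony-suc⇔ n = not-∧-≡ᵇ-true⇔

grundy : List ℕ → List ℕ → ℕ
grundy B H = ⨁ (map ε B ++ H)

grundy-block : ∀ xs c ys H → grundy (xs ++ c ∷ ys) H ≡ ε c ⊕ grundy (xs ++ ys) H
grundy-block xs c ys H = begin
  ⨁ (map ε (xs ++ c ∷ ys) ++ H)          ≡⟨ cong (λ l → ⨁ (l ++ H)) (map-++ ε xs (c ∷ ys)) ⟩
  ⨁ ((εxs ++ ε c ∷ εys) ++ H)            ≡⟨ cong ⨁ (++-assoc εxs (ε c ∷ εys) H) ⟩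
  ⨁ (εxs ++ ε c ∷ εys ++ H)              ≡⟨ ⨁-middle εxs (ε c) (εys ++ H) ⟩
  ε c ⊕ ⨁ (εxs ++ εys ++ H)              ≡⟨ cong (λ l → ε c ⊕ ⨁ l) (++-assoc εxs εys H) ⟨
  ε c ⊕ ⨁ ((εxs ++ εys) ++ H)            ≡⟨ cong (λ l → ε c ⊕ ⨁ (l ++ H)) (map-++ ε xs ys) ⟨
  ε c ⊕ ⨁ (map ε (xs ++ ys) ++ H)        ∎
  where
  open ≡-Reasoning
  εxs = map ε xs
  εys = map ε ys

grundy-heap : ∀ B xs c ys → grundy B (xs ++ c ∷ ys) ≡ c ⊕ grundy B (xs ++ ys)
grundy-heap B xs c ys = begin
  ⨁ (map ε B ++ xs ++ c ∷ ys)    ≡⟨ cong ⨁ (++-assoc (map ε B) xs (c ∷ ys)) ⟨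
  ⨁ ((map ε B ++ xs) ++ c ∷ ys)  ≡⟨ ⨁-middle (map ε B ++ xs) c ys ⟩
  c ⊕ ⨁ ((map ε B ++ xs) ++ ys)  ≡⟨ cong (λ l → c ⊕ ⨁ l) (++-assoc (map ε B) xs ys) ⟩
  c ⊕ ⨁ (map ε B ++ xs ++ ys)    ∎
  where open ≡-Reasoning

winsWith : Maybe Ent → ℕ → Bool
winsWith nothing          g = not (g ≡ᵇ 0)
winsWith (just dot)       g = g ≡ᵇ 0
winsWith (just (col n))   g = colLoony n ∨ not (g ≡ᵇ ε n)
winsWith (just (dcol n))  g = not (winsWith (just (col n)) g)
winsWith (just (two a b)) g = (colLoony a ∨ colLoony b) ∨ not (g ≡ᵇ ε a ⊕ ε b)

wins : State → Bool
wins ⟨ B , H , e ⟩ = winsWith e (grundy B H)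

wins-after-pairT : ∀ m1 m2 R H →
  wins (after (pairT m1 m2) R H) ≡ pairLoony m1 m2 ∨ not (grundy R H ≡ᵇ optionValue ε m1 m2)
wins-after-pairT zero    zero    R H = refl
wins-after-pairT zero    (suc b) R H =
  cong (λ v → colLoony b ∨ not (grundy R H ≡ᵇ v)) (sym (⊕-identityˡ (ε b)))
wins-after-pairT (suc a) zero    R H =
  cong (λ v → colLoony a ∨ not (grundy R H ≡ᵇ v)) (sym (⊕-identityʳ (ε a)))
wins-after-pairT (suc a) (suc b) R H = refl

option≢ε-suc : ∀ {k} m1 m2 → m1 + m2 ≡ k → pairLoony m1 m2 ≡ false →
               optionValue ε m1 m2 ≢ ε (suc k)
option≢ε-suc m1 m2 eq nl v≡ = proj₁ (ε-suc-isMex _) (m1 , m2 , eq , nl , sym v≡)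

wins-losing-closed : ∀ {s s'} → wins s ≡ false → s ⟶ s' → wins s' ≡ true
wins-losing-closed {⟨ _ , H , _ ⟩} l (blockMv xs ys k m1 m2 refl refl) =
  trans (wins-after-pairT m1 m2 (xs ++ ys) H)
        (∨-not-≡ᵇ-true (pairLoony m1 m2) λ nl r≡v →
           option≢ε-suc m1 m2 refl nl (trans (sym r≡v) r≡ε))
  where
  r≡ε : grundy (xs ++ ys) H ≡ ε (suc (m1 + m2))
  r≡ε = sym (x⊕y≡0⇒x≡y _ _ (trans (sym (grundy-block xs _ ys H)) (not-≡ᵇ-false⁻ l)))
wins-losing-closed {⟨ B , _ , _ ⟩} l (heapMv xs ys k j refl j<1+k) =
  not-≡ᵇ-true λ g′≡0 →
    <-irrefl (trans (heap≡r j (sym (grundy-heap B xs j ys)) g′≡0)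
                    (sym (heap≡r (suc k) (sym (grundy-heap B xs _ ys)) (not-≡ᵇ-false⁻ l))))
             j<1+k
  where
  heap≡r : ∀ c {g} → c ⊕ grundy B (xs ++ ys) ≡ g → g ≡ 0 → c ≡ grundy B (xs ++ ys)
  heap≡r c eq g≡0 = x⊕y≡0⇒x≡y _ _ (trans eq g≡0)
wins-losing-closed {⟨ B , H , _ ⟩} l (entMv _ (col-cap n)) with ∨-not-≡ᵇ-false⁻ (colLoony n) l
... | _ , g≡ε = ≡⇒≡ᵇ-true (trans (cong (ε n ⊕_) g≡ε) (x⊕x≡0 (ε n)))
wins-losing-closed () (entMv _ (col-adv zero))
wins-losing-closed {⟨ B , H , _ ⟩} l (entMv _ (col-adv (suc n)))
  with ∨-not-≡ᵇ-false⁻ (colLoony (suc n)) l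
... | not-loony , g≡ε = ∨-not-≡ᵇ-true (colLoony n) {grundy B H} λ nl g≡ε′ →
  Bool.not-¬ not-loony (Equivalence.from (colLoony-suc⇔ n) (nl , trans (sym g≡ε) g≡ε′))
wins-losing-closed l (entMv _ dot-cap) = cong not l
wins-losing-closed l (entMv _ (two-l a b)) with ∨-not-≡ᵇ-false⁻ (colLoony a ∨ colLoony b) l
... | nl , g≡ = cong not (∨-not-≡ᵇ-false (proj₂ (Equivalence.to ∨-≡-false⇔ nl))
                                       (trans (cong (ε a ⊕_) g≡) (x⊕[x⊕y]≡y (ε a) (ε b))))
wins-losing-closed l (entMv _ (two-r a b)) with ∨-not-≡ᵇ-false⁻ (colLoony a ∨ colLoony b) l
... | nl , g≡ = cong not (∨-not-≡ᵇ-false (proj₁ (Equivalence.to ∨-≡-false⇔ nl))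
                                       (trans (cong (ε b ⊕_) (trans g≡ (⊕-comm (ε a) (ε b))))
                                              (x⊕[x⊕y]≡y (ε b) (ε a))))
wins-losing-closed l (entMv _ (dcol-mv n)) = Bool.not-injective l

LosingMove : State → Set
LosingMove s = Σ State λ s' → (s ⟶ s') × (wins s' ≡ false)

private
  Any-split : ∀ {P : ℕ → Set} {l} → Any P l →
              Σ (List ℕ) λ xs → Σ (List ℕ) λ ys → Σ ℕ λ c → (l ≡ xs ++ c ∷ ys) × P c
  Any-split p with find p
  ... | c , c∈ , pc with ∈-∃++ c∈
  ...   | xs , ys , eq = xs , ys , c , eq , pc

reduce-block : ∀ B H xs ys b → B ≡ xs ++ b ∷ ys → ε b ⊕ grundy B H < ε b →
               LosingMove ⟨ B , H , nothing ⟩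
reduce-block B H xs ys (suc k) refl lt with proj₂ (ε-suc-isMex k) _ lt
... | m1 , m2 , eq , nl , v≡ =
  _ , blockMv xs ys k m1 m2 refl eq ,
  trans (wins-after-pairT m1 m2 (xs ++ ys) H) (∨-not-≡ᵇ-false nl r≡v)
  where
  r≡v : grundy (xs ++ ys) H ≡ optionValue ε m1 m2
  r≡v = trans (sym (x⊕[x⊕y]≡y (ε (suc k)) _))
              (trans (cong (ε (suc k) ⊕_) (sym (grundy-block xs (suc k) ys H))) v≡)

reduce-heap : ∀ B H xs ys c → H ≡ xs ++ c ∷ ys → c ⊕ grundy B H < c →
              LosingMove ⟨ B , H , nothing ⟩
reduce-heap B H xs ys (suc k) refl lt =
  _ , heapMv xs ys k _ refl lt , cong not (≡⇒≡ᵇ-true (begin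
    grundy B (xs ++ (c ⊕ g) ∷ ys) ≡⟨ grundy-heap B xs (c ⊕ g) ys ⟩
    (c ⊕ g) ⊕ r                   ≡⟨ cong (λ h → (c ⊕ h) ⊕ r) (grundy-heap B xs c ys) ⟩
    (c ⊕ (c ⊕ r)) ⊕ r             ≡⟨ cong (_⊕ r) (x⊕[x⊕y]≡y c r) ⟩
    r ⊕ r                         ≡⟨ x⊕x≡0 r ⟩
    0                             ∎))
  where
  open ≡-Reasoning
  c = suc k
  g = grundy B (xs ++ c ∷ ys)
  r = grundy B (xs ++ ys)

col-advance : ∀ B H n → colLoony n ≡ true → grundy B H ≡ ε n →
              LosingMove ⟨ B , H , just (col n) ⟩
col-advance B H zero    _     g≡ε = _ , entMv _ (col-adv zero) , cong not (≡⇒≡ᵇ-true g≡ε)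
col-advance B H (suc n) loony g≡ε with Equivalence.to (colLoony-suc⇔ n) loony
... | nl , ε≡ = _ , entMv _ (col-adv (suc n)) , ∨-not-≡ᵇ-false nl (trans g≡ε ε≡)

wins-winning-move : ∀ s → wins s ≡ true → LosingMove s
wins-winning-move ⟨ B , H , nothing ⟩ w
  with Any.++⁻ (map ε B) (⨁-reducible (map ε B ++ H) (not-≡ᵇ-true⁻ w))
... | inj₁ in-blocks = let xs , ys , b , eq , lt = Any-split (Any.map⁻ in-blocks)
                       in reduce-block B H xs ys b eq lt
... | inj₂ in-heaps  = let xs , ys , c , eq , lt = Any-split in-heaps
                       in reduce-heap B H xs ys c eq lt
wins-winning-move ⟨ B , H , just dot ⟩ w = _ , entMv _ dot-cap , cong not w
wins-winning-move ⟨ B , H , just (col n) ⟩ w with grundy B H ≟ ε n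
... | no  g≢ε =
  _ , entMv _ (col-cap n) , Bool.¬-not (λ eq → g≢ε (sym (x⊕y≡0⇒x≡y _ _ (≡ᵇ-true⇒≡ eq))))
... | yes g≡ε = col-advance B H n (∨-not-≡ᵇ-true⁻ (colLoony n) w g≡ε) g≡ε
wins-winning-move ⟨ B , H , just (dcol n) ⟩ w = _ , entMv _ (dcol-mv n) , Bool.not-injective w
wins-winning-move ⟨ B , H , just (two a b) ⟩ w with colLoony a in la | colLoony b in lb
... | _     | true  =
  _ , entMv _ (two-l a b) , cong (λ x → not (x ∨ not (grundy (a ∷ B) H ≡ᵇ ε b))) lb
... | true  | false =
  _ , entMv _ (two-r a b) , cong (λ x → not (x ∨ not (grundy (b ∷ B) H ≡ᵇ ε a))) la
... | false | false =
  _ , entMv _ (two-l a b) , cong not (∨-not-≡ᵇ-true (colLoony b) λ _ eq →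
    not-≡ᵇ-true⁻ w (trans (sym (x⊕[x⊕y]≡y (ε a) _)) (cong (ε a ⊕_) eq)))

open Outcome wins wins-losing-closed wins-winning-move using (Win⇔wins)

Win-cong : ∀ {s s'} → wins s ≡ wins s' → Win s ⇔ Win s'
Win-cong {s} {s'} eq = mk⇔
  (λ w → Equivalence.from (Win⇔wins s') (trans (sym eq) (Equivalence.to (Win⇔wins s) w)))
  (λ w → Equivalence.from (Win⇔wins s) (trans eq (Equivalence.to (Win⇔wins s') w)))

-- Classification of moves

Loony-pairT⇔ : ∀ m1 m2 → Loony (pairT m1 m2) ⇔ pairLoony m1 m2 ≡ true
Loony-pairT⇔ m1 m2 = mk⇔ to from
  where
  v = optionValue ε m1 m2
  to : Loony (pairT m1 m2) → pairLoony m1 m2 ≡ true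
  to loony = ∨-not-≡ᵇ-true⁻ (pairLoony m1 m2)
    (trans (sym (wins-after-pairT m1 m2 [] (v ∷ [])))
           (Equivalence.to (Win⇔wins _) (loony [] (v ∷ []))))
    (⊕-identityʳ v)
  from : pairLoony m1 m2 ≡ true → Loony (pairT m1 m2)
  from l R H = Equivalence.from (Win⇔wins _)
    (trans (wins-after-pairT m1 m2 R H) (cong (_∨ not (grundy R H ≡ᵇ v)) l))

¬Loony-pairT⇔ : ∀ m1 m2 → (¬ Loony (pairT m1 m2)) ⇔ pairLoony m1 m2 ≡ false
¬Loony-pairT⇔ m1 m2 = mk⇔
  (λ nl → Bool.¬-not (nl ∘ Equivalence.from (Loony-pairT⇔ m1 m2)))
  (λ nl → Bool.not-¬ nl ∘ Equivalence.to (Loony-pairT⇔ m1 m2))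

private
  ≡ᵇ-via-⊕ : ∀ g v → (g ≡ᵇ v) ≡ (v ⊕ g ≡ᵇ 0)
  ≡ᵇ-via-⊕ g v with g ≟ v
  ... | yes refl = trans (≡⇒≡ᵇ-true {g} refl) (sym (≡⇒≡ᵇ-true (x⊕x≡0 g)))
  ... | no  g≢v = trans (Bool.¬-not (g≢v ∘ ≡ᵇ-true⇒≡))
                        (sym (Bool.¬-not (g≢v ∘ sym ∘ x⊕y≡0⇒x≡y v g ∘ ≡ᵇ-true⇒≡)))

pairT-MoveEquiv : ∀ m1 m2 X → pairLoony m1 m2 ≡ false →
  (∀ R H → grundy (X ++ R) H ≡ optionValue ε m1 m2 ⊕ grundy R H) → MoveEquiv (pairT m1 m2) X
pairT-MoveEquiv m1 m2 X nl grundy-X R H = Win-cong (begin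
  wins (after (pairT m1 m2) R H)      ≡⟨ wins-after-pairT m1 m2 R H ⟩
  pairLoony m1 m2 ∨ not (g ≡ᵇ v)      ≡⟨ cong (_∨ not (g ≡ᵇ v)) nl ⟩
  not (g ≡ᵇ v)                        ≡⟨ cong not (≡ᵇ-via-⊕ g v) ⟩
  not (v ⊕ g ≡ᵇ 0)                    ≡⟨ cong (λ h → not (h ≡ᵇ 0)) (grundy-X R H) ⟨
  wins ⟨ X ++ R , H , nothing ⟩       ∎)
  where
  open ≡-Reasoning
  g = grundy R H
  v = optionValue ε m1 m2

≅*-from-grundy : ∀ X k → (∀ R H → grundy (X ++ R) H ≡ k ⊕ grundy R H) → X ≅* k
≅*-from-grundy X k grundy-X R H E =
  Win-cong (cong (winsWith E) (trans (grundy-X R H) (sym (grundy-heap R [] k H))))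

IsMex-cong : ∀ {S T : ℕ → Set} {v} → (∀ u → S u → T u) → (∀ u → T u → S u) →
             IsMex S v → IsMex T v
IsMex-cong S⇒T T⇒S (v∉S , below) = v∉S ∘ T⇒S _ , λ u u<v → S⇒T u (below u u<v)

block≅*ε : ∀ m → (m ∷ []) ≅* ε m
block≅*ε m = ≅*-from-grundy (m ∷ []) (ε m) (λ _ _ → refl)

blockPair≅* : ∀ a b → (a ∷ b ∷ []) ≅* (ε a ⊕ ε b)
blockPair≅* a b = ≅*-from-grundy (a ∷ b ∷ []) (ε a ⊕ ε b) (λ R H → sym (⊕-assoc (ε a) (ε b) _))

Loony-colT1 : Loony (colT 1)
Loony-colT1 = Equivalence.from (Loony-pairT⇔ 0 1) refl

colT-Loony⊎MoveEquiv : ∀ m → 1 < m → Loony (colT m) ⊎ MoveEquiv (colT m) ((m ∸ 1) ∷ [])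
colT-Loony⊎MoveEquiv (suc zero) (s≤s ())
colT-Loony⊎MoveEquiv (suc (suc j)) _ with colLoony (suc j) in l
... | true  = inj₁ (Equivalence.from (Loony-pairT⇔ 0 (suc (suc j))) l)
... | false = inj₂ (pairT-MoveEquiv 0 (suc (suc j)) (suc j ∷ []) l
                      (λ R H → cong (_⊕ grundy R H) (sym (⊕-identityˡ (ε (suc j))))))

Loony-colT⇔ : ∀ m → 1 < m → Loony (colT m) ⇔ (¬ Loony (colT (m ∸ 1)) × ε (m ∸ 1) ≡ ε (m ∸ 2))
Loony-colT⇔ (suc zero) (s≤s ())
Loony-colT⇔ (suc (suc j)) _ = mk⇔
  (λ loony → let nl , ε≡ = Equivalence.to (colLoony-suc⇔ j)
                                (Equivalence.to (Loony-pairT⇔ 0 (suc (suc j))) loony)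
             in Equivalence.from (¬Loony-pairT⇔ 0 (suc j)) nl , ε≡)
  (λ (nl , ε≡) → Equivalence.from (Loony-pairT⇔ 0 (suc (suc j)))
     (Equivalence.from (colLoony-suc⇔ j) (Equivalence.to (¬Loony-pairT⇔ 0 (suc j)) nl , ε≡)))

pairT-Loony⊎MoveEquiv : ∀ a b →
  Loony (pairT (suc a) (suc b)) ⊎ MoveEquiv (pairT (suc a) (suc b)) (a ∷ b ∷ [])
pairT-Loony⊎MoveEquiv a b with pairLoony (suc a) (suc b) in l
... | true  = inj₁ (Equivalence.from (Loony-pairT⇔ (suc a) (suc b)) l)
... | false = inj₂ (pairT-MoveEquiv (suc a) (suc b) (a ∷ b ∷ []) l
                      (λ R H → sym (⊕-assoc (ε a) (ε b) _)))

¬Loony-pairT⇔¬Loony-colT : ∀ a b →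
  (¬ Loony (pairT (suc a) (suc b))) ⇔ (¬ Loony (colT (suc a)) × ¬ Loony (colT (suc b)))
¬Loony-pairT⇔¬Loony-colT a b = mk⇔
  (λ nl → let la , lb = Equivalence.to ∨-≡-false⇔ (Equivalence.to (¬Loony-pairT⇔ (suc a) (suc b)) nl)
          in Equivalence.from (¬Loony-pairT⇔ 0 (suc a)) la ,
             Equivalence.from (¬Loony-pairT⇔ 0 (suc b)) lb)
  (λ (na , nb) → Equivalence.from (¬Loony-pairT⇔ (suc a) (suc b))
     (Equivalence.from ∨-≡-false⇔ (Equivalence.to (¬Loony-pairT⇔ 0 (suc a)) na ,
                                   Equivalence.to (¬Loony-pairT⇔ 0 (suc b)) nb)))

ε-isMex : ∀ m → 1 < m → IsMex (Options ε (m ∸ 1)) (ε m)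
ε-isMex (suc zero) (s≤s ())
ε-isMex (suc (suc j)) _ = IsMex-cong
  (λ { u (m1 , m2 , eq , nl , u≡) → m1 , m2 , eq , Equivalence.from (¬Loony-pairT⇔ m1 m2) nl , u≡ })
  (λ { u (m1 , m2 , eq , nl , u≡) → m1 , m2 , eq , Equivalence.to (¬Loony-pairT⇔ m1 m2) nl , u≡ })
  (ε-suc-isMex (suc j))

theorem1 : Σ (ℕ → ℕ) λ ε →
      ((m : ℕ) → (m ∷ []) ≅* ε m)
    × Loony (colT 1)
    × ((m : ℕ) → 1 < m → Loony (colT m) ⊎ MoveEquiv (colT m) ((m ∸ 1) ∷ []))
    × ((m : ℕ) → 1 < m →
         Loony (colT m) ⇔ (¬ Loony (colT (m ∸ 1)) × ε (m ∸ 1) ≡ ε (m ∸ 2)))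
    × ((m1 m2 : ℕ) → 0 < m1 → 0 < m2 →
         (Loony (pairT m1 m2) ⊎ MoveEquiv (pairT m1 m2) ((m1 ∸ 1) ∷ (m2 ∸ 1) ∷ []))
         × ((m1 ∸ 1) ∷ (m2 ∸ 1) ∷ []) ≅* (ε (m1 ∸ 1) ⊕ ε (m2 ∸ 1)))
    × ((m1 m2 : ℕ) → 0 < m1 → 0 < m2 →
         (¬ Loony (pairT m1 m2)) ⇔ (¬ Loony (colT m1) × ¬ Loony (colT m2)))
    × ε 0 ≡ 0
    × ε 1 ≡ 1
    × ((m : ℕ) → 1 < m → IsMex (Options ε (m ∸ 1)) (ε m))
theorem1 =
  ε , block≅*ε , Loony-colT1 , colT-Loony⊎MoveEquiv , Loony-colT⇔ ,
  (λ { (suc a) (suc b) _ _ → pairT-Loony⊎MoveEquiv a b , blockPair≅* a b }) ,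
  (λ { (suc a) (suc b) _ _ → ¬Loony-pairT⇔¬Loony-colT a b }) ,
  refl , refl , ε-isMex
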